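{- Let $P$ be a set of pairwise non-attacking rooks in $\{1,\dots,n\}^3$, let $I,J,K\subseteq N=\{1,\dots,n\}$ with $|I|=a,|J|=b,|K|=c$, $T_0=I\times J\times K$, $T_3=I^c\times J^c\times K^c$, let $c_0,c_3$ be the numbers of rooks of $P$ in $T_0,T_3$, and $\operatorname{def}(T_0,T_3)=n^2-(a+b+c)n+ab+bc+ca-c_0-c_3$. Then $$\operatorname{def}(T_0,T_3)=E_z(I\times J\times N)+E_z(I\times J^c\times N)+E_z(I^c\times J^c\times N)-E_x(N\times J^c\times K)-E_y(I\times N\times K^c).$$
   Context: Two rooks are non-attacking if they agree in at most one coordinate. A file of direction $x$ is $\{(t,j,k):t\in N\}$ for fixed $(j,k)$, similarly for $y,z$. For a brick $X$ with full range $N$ in direction $x$, $E_x(X)$ is the number of $x$-directional files in $X$ containing no rook of $P$; $E_y,E_z$ analogously. In the paper's notation, with $T_{1b}=I\times J^c\times K$, $T_{1c}=I\times J\times K^c$, $T_{2ab}=I^c\times J^c\times K$, $T_{2bc}=I\times J^c\times K^c$, the bricks are $T_0\cup T_{1c}$, $T_{1b}\cup T_{2bc}$, $T_{2ab}\cup T_3$, $T_{1b}\cup T_{2ab}$, $T_{1c}\cup T_{2bc}$. -}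

module Defs where

open import Data.Nat using (ℕ; zero; suc; _+_; _*_; _≤_; _≡ᵇ_)
open import Data.Bool using (Bool; true; false; _∧_; not; if_then_else_)
open import Data.Fin using (Fin; zero; suc)
open import Data.Fin.Properties using (_≟_)
open import Data.Fin.Subset using (Subset; ∁; ∣_∣)
open import Data.Vec using (lookup)
open import Data.Product using (_×_; _,_)
open import Data.Integer using (ℤ; +_; _-_) renaming (_+_ to _+ℤ_)
open import Relation.Nullary.Decidable.Core using (isYes)
open import Relation.Binary.PropositionalEquality using (_≡_; _≢_)

_∈ᵇ_ : ∀ {n} → Fin n → Subset n → Bool
i ∈ᵇ S = lookup S i

sumF : ∀ n → (Fin n → ℕ) → ℕ
sumF zero    f = 0
sumF (suc n) f = f zero + sumF n (λ i → f (suc i))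

count : ∀ n → (Fin n → Bool) → ℕ
count n f = sumF n (λ i → if f i then 1 else 0)

-- cells of the cube N^3, N = Fin n (standing for {1,…,n})
Cell : ℕ → Set
Cell n = Fin n × Fin n × Fin n

Rooks : ℕ → Set
Rooks n = Cell n → Bool

agreements : ∀ {n} → Cell n → Cell n → ℕ
agreements (i , j , k) (i' , j' , k') =
  eqF i i' + eqF j j' + eqF k k'
  where
  eqF : ∀ {m} → Fin m → Fin m → ℕ
  eqF a b = if isYes (a ≟ b) then 1 else 0

NonAttacking : ∀ {n} → Rooks n → Set
NonAttacking {n} P =
  (r s : Cell n) → P r ≡ true → P s ≡ true → r ≢ s → agreements r s ≤ 1

rooksIn : ∀ {n} → Rooks n → Subset n → Subset n → Subset n → ℕ
rooksIn {n} P A B C =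
  sumF n λ i → sumF n λ j → count n λ k →
    (i ∈ᵇ A) ∧ (j ∈ᵇ B) ∧ (k ∈ᵇ C) ∧ P (i , j , k)

-- E_z(A × B × N): number of z-files {(i,j,t) : t ∈ N} with i ∈ A, j ∈ B
-- that contain no rook of P
Ez : ∀ {n} → Rooks n → Subset n → Subset n → ℕ
Ez {n} P A B = sumF n λ i → count n λ j →
  (i ∈ᵇ A) ∧ (j ∈ᵇ B) ∧ (count n (λ t → P (i , j , t)) ≡ᵇ 0)

Ex : ∀ {n} → Rooks n → Subset n → Subset n → ℕ
Ex {n} P B C = sumF n λ j → count n λ k →
  (j ∈ᵇ B) ∧ (k ∈ᵇ C) ∧ (count n (λ t → P (t , j , k)) ≡ᵇ 0)

Ey : ∀ {n} → Rooks n → Subset n → Subset n → ℕ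
Ey {n} P A C = sumF n λ i → count n λ k →
  (i ∈ᵇ A) ∧ (k ∈ᵇ C) ∧ (count n (λ t → P (i , t , k)) ≡ᵇ 0)

deficiency : ∀ {n} → Rooks n → Subset n → Subset n → Subset n → ℤ
deficiency {n} P I J K =
  (+ (n * n) - + ((a + b + c) * n) +ℤ + (a * b + b * c + c * a))
    - + (rooksIn P I J K) - + (rooksIn P (∁ I) (∁ J) (∁ K))
  where
  a = ∣ I ∣
  b = ∣ J ∣
  c = ∣ K ∣

-- No two rooks share a file, so each file of a box A × B × N holds at most one
-- rook and E_z(A × B × N) = |A| |B| − (number of rooks in the box); likewise for
-- E_x and E_y. The bricks T₃, N × Jᶜ × K, I × N × Kᶜ, T₀ cover every cell exactly
-- as often as I × J × N, I × Jᶜ × N, Iᶜ × Jᶜ × N do, so all rook counts cancel and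
-- what remains is a polynomial identity in n, |I|, |J|, |K|.
module Submission where

open import Defs
open import Algebra.Properties.Semiring.Sum as Sum using ()
open import Data.Bool using (Bool; true; false; _∧_; not; if_then_else_)
open import Data.Bool.Properties using (¬-not)
open import Data.Fin using (Fin; zero; suc)
open import Data.Fin.Properties using (_≟_; suc-injective)
open import Data.Fin.Subset using (Subset; ∁; ⊤; ∣_∣)
open import Data.Fin.Subset.Properties using (∣∁p∣≡n∸∣p∣; ∣p∣≤n)
open import Data.Integer using (ℤ; +_; _-_) renaming (_+_ to _+ℤ_; _*_ to _*ℤ_)
open import Data.Integer.Properties using (pos-*)
open import Data.Integer.Tactic.RingSolver using (solve; solve-∀)
open import Data.List using (_∷_; [])
open import Data.Nat using (ℕ; zero; suc; _+_; _*_; _≤_; z≤n; s≤s; _≡ᵇ_)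
open import Data.Nat.Properties
  using (+-*-semiring; ≤-reflexive; +-mono-≤; ≤⇒≯; m+[n∸m]≡n; +-identityʳ)
open import Data.Product using (_,_)
open import Data.Vec as Vec using (lookup)
open import Data.Vec.Properties using (lookup-map; lookup-replicate)
open import Function using (_∘_)
open import Relation.Binary.PropositionalEquality
  using (_≡_; refl; sym; trans; cong; cong₂; ≡-≟-identity; module ≡-Reasoning)
open import Relation.Nullary using (yes; no)
open import Relation.Nullary.Decidable.Core using (isYes)
open import Relation.Nullary.Negation using (contradiction)

open Sum +-*-semiring
  using (sum; sum-cong-≗; ∑-distrib-+; ∑-comm; *-distribˡ-sum; *-distribʳ-sum)
open ≡-Reasoning

-- count n g is definitionally sumF n (χ ∘ g).
χ : Bool → ℕ
χ b = if b then 1 else 0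

sumF≡sum : ∀ n (f : Fin n → ℕ) → sumF n f ≡ sum f
sumF≡sum zero    f = refl
sumF≡sum (suc n) f = cong (_+_ (f zero)) (sumF≡sum n (f ∘ suc))

sumF-cong : ∀ n {f g : Fin n → ℕ} → (∀ i → f i ≡ g i) → sumF n f ≡ sumF n g
sumF-cong n {f} {g} f≗g = begin
  sumF n f ≡⟨ sumF≡sum n f ⟩
  sum f    ≡⟨ sum-cong-≗ f≗g ⟩
  sum g    ≡⟨ sumF≡sum n g ⟨
  sumF n g ∎

sumF-distrib-+ : ∀ n (f g : Fin n → ℕ) → sumF n (λ i → f i + g i) ≡ sumF n f + sumF n g
sumF-distrib-+ n f g = begin
  sumF n (λ i → f i + g i) ≡⟨ sumF≡sum n _ ⟩
  sum (λ i → f i + g i)    ≡⟨ ∑-distrib-+ f g ⟩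
  sum f + sum g            ≡⟨ cong₂ _+_ (sumF≡sum n f) (sumF≡sum n g) ⟨
  sumF n f + sumF n g      ∎

sumF-comm : ∀ m n (f : Fin m → Fin n → ℕ) →
  sumF m (λ i → sumF n (f i)) ≡ sumF n (λ j → sumF m (λ i → f i j))
sumF-comm m n f = begin
  sumF m (λ i → sumF n (f i))            ≡⟨ sumF-cong m (λ i → sumF≡sum n (f i)) ⟩
  sumF m (λ i → sum (f i))               ≡⟨ sumF≡sum m _ ⟩
  sum (λ i → sum (f i))                  ≡⟨ ∑-comm f ⟩
  sum (λ j → sum (λ i → f i j))          ≡⟨ sumF≡sum n _ ⟨
  sumF n (λ j → sum (λ i → f i j))       ≡⟨ sumF-cong n (λ j → sumF≡sum m (λ i → f i j)) ⟨
  sumF n (λ j → sumF m (λ i → f i j))    ∎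

sumF-*-sumF : ∀ m n (f : Fin m → ℕ) (g : Fin n → ℕ) →
  sumF m (λ i → sumF n (λ j → f i * g j)) ≡ sumF m f * sumF n g
sumF-*-sumF m n f g = begin
  sumF m (λ i → sumF n (λ j → f i * g j))
    ≡⟨ sumF-cong m (λ i → trans (sumF≡sum n _) (sym (*-distribˡ-sum (f i) g))) ⟩
  sumF m (λ i → f i * sum g) ≡⟨ sumF≡sum m _ ⟩
  sum (λ i → f i * sum g)    ≡⟨ *-distribʳ-sum (sum g) f ⟨
  sum f * sum g              ≡⟨ cong₂ _*_ (sumF≡sum m f) (sumF≡sum n g) ⟨
  sumF m f * sumF n g        ∎

sumF³ : ∀ n → (Fin n → Fin n → Fin n → ℕ) → ℕ
sumF³ n f = sumF n λ i → sumF n λ j → sumF n λ k → f i j k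

sumF³-cong : ∀ n {f g : Fin n → Fin n → Fin n → ℕ} →
  (∀ i j k → f i j k ≡ g i j k) → sumF³ n f ≡ sumF³ n g
sumF³-cong n f≗g = sumF-cong n λ i → sumF-cong n λ j → sumF-cong n λ k → f≗g i j k

sumF³-distrib-+ : ∀ n (f g : Fin n → Fin n → Fin n → ℕ) →
  sumF³ n (λ i j k → f i j k + g i j k) ≡ sumF³ n f + sumF³ n g
sumF³-distrib-+ n f g =
  trans (sumF-cong n λ i → trans (sumF-cong n λ j → sumF-distrib-+ n (f i j) (g i j))
                                 (sumF-distrib-+ n _ _))
        (sumF-distrib-+ n _ _)

count≡0 : ∀ n (g : Fin n → Bool) → (∀ t → g t ≡ false) → count n g ≡ 0
count≡0 zero    g g≡false = refl
count≡0 (suc n) g g≡false rewrite g≡false zero = count≡0 n (g ∘ suc) (g≡false ∘ suc)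

count≤1 : ∀ n (g : Fin n → Bool) →
  (∀ t t' → g t ≡ true → g t' ≡ true → t ≡ t') → count n g ≤ 1
count≤1 zero    g unique = z≤n
count≤1 (suc n) g unique with g zero in g₀
... | true  = ≤-reflexive (cong suc (count≡0 n (g ∘ suc) λ t →
                ¬-not λ gₜ → contradiction (unique (suc t) zero gₜ g₀) λ ()))
... | false = count≤1 n (g ∘ suc) λ t t' p q → suc-injective (unique (suc t) (suc t') p q)

file-rooks+empty : ∀ n a b (g : Fin n → Bool) → count n g ≤ 1 →
  count n (λ t → a ∧ b ∧ g t) + χ (a ∧ b ∧ (count n g ≡ᵇ 0)) ≡ χ a * χ b
file-rooks+empty n false b     g _ = trans (+-identityʳ _) (count≡0 n _ λ _ → refl)
file-rooks+empty n true  false g _ = trans (+-identityʳ _) (count≡0 n _ λ _ → refl)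
file-rooks+empty n true  true  g g≤1 with count n g | g≤1
... | .0 | z≤n       = refl
... | .1 | s≤s z≤n   = refl

rooks+empty-files : ∀ n (α β : Fin n → Bool) (q : Fin n → Fin n → Fin n → Bool) →
  (∀ i j → count n (q i j) ≤ 1) →
  sumF n (λ i → sumF n (λ j → count n (λ t → α i ∧ β j ∧ q i j t)))
    + sumF n (λ i → count n (λ j → α i ∧ β j ∧ (count n (q i j) ≡ᵇ 0)))
  ≡ count n α * count n β
rooks+empty-files n α β q q≤1 = begin
  sumF n (λ i → sumF n (λ j → count n (λ t → α i ∧ β j ∧ q i j t)))
    + sumF n (λ i → count n (λ j → α i ∧ β j ∧ (count n (q i j) ≡ᵇ 0)))
    ≡⟨ sumF-distrib-+ n _ _ ⟨
  sumF n (λ i → sumF n (λ j → count n (λ t → α i ∧ β j ∧ q i j t))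
                  + count n (λ j → α i ∧ β j ∧ (count n (q i j) ≡ᵇ 0)))
    ≡⟨ sumF-cong n (λ i → sumF-distrib-+ n _ _) ⟨
  sumF n (λ i → sumF n (λ j → count n (λ t → α i ∧ β j ∧ q i j t)
                                + χ (α i ∧ β j ∧ (count n (q i j) ≡ᵇ 0))))
    ≡⟨ sumF-cong n (λ i → sumF-cong n λ j → file-rooks+empty n (α i) (β j) (q i j) (q≤1 i j)) ⟩
  sumF n (λ i → sumF n (λ j → χ (α i) * χ (β j)))
    ≡⟨ sumF-*-sumF n n (χ ∘ α) (χ ∘ β) ⟩
  count n α * count n β ∎

∣p∣≡count : ∀ {n} (p : Subset n) → ∣ p ∣ ≡ count n (lookup p)
∣p∣≡count Vec.[]            = refl
∣p∣≡count (true  Vec.∷ p)   = cong suc (∣p∣≡count p)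
∣p∣≡count (false Vec.∷ p)   = ∣p∣≡count p

∣p∣+∣∁p∣≡n : ∀ {n} (p : Subset n) → ∣ p ∣ + ∣ ∁ p ∣ ≡ n
∣p∣+∣∁p∣≡n p = trans (cong (_+_ ∣ p ∣) (∣∁p∣≡n∸∣p∣ p)) (m+[n∸m]≡n (∣p∣≤n p))

∈⊤ : ∀ {n} (i : Fin n) → i ∈ᵇ ⊤ ≡ true
∈⊤ i = lookup-replicate i true

agreement-refl : ∀ {m} (i : Fin m) → 1 ≤ (if isYes (i ≟ i) then 1 else 0)
agreement-refl i =
  ≤-reflexive (sym (cong (λ d → if isYes d then 1 else 0) (≡-≟-identity _≟_ refl)))

module _ {n : ℕ} {P : Rooks n} (non-attacking : NonAttacking P) where

  rooks-on-file≤1 : (ℓ : Fin n → Cell n) → (∀ {t t'} → ℓ t ≡ ℓ t' → t ≡ t') →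
    (∀ t t' → 2 ≤ agreements (ℓ t) (ℓ t')) → count n (P ∘ ℓ) ≤ 1
  rooks-on-file≤1 ℓ ℓ-injective two-agreements = count≤1 n (P ∘ ℓ) unique
    where
    unique : ∀ t t' → P (ℓ t) ≡ true → P (ℓ t') ≡ true → t ≡ t'
    unique t t' p q with t ≟ t'
    ... | yes t≡t' = t≡t'
    ... | no  t≢t' = contradiction (two-agreements t t')
                       (≤⇒≯ (non-attacking _ _ p q (t≢t' ∘ ℓ-injective)))

  x-file≤1 : ∀ j k → count n (λ t → P (t , j , k)) ≤ 1
  x-file≤1 j k = rooks-on-file≤1 (λ t → t , j , k) (λ { refl → refl })
    λ _ _ → +-mono-≤ (+-mono-≤ z≤n (agreement-refl j)) (agreement-refl k)

  y-file≤1 : ∀ i k → count n (λ t → P (i , t , k)) ≤ 1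
  y-file≤1 i k = rooks-on-file≤1 (λ t → i , t , k) (λ { refl → refl })
    λ _ _ → +-mono-≤ (+-mono-≤ (agreement-refl i) z≤n) (agreement-refl k)

  z-file≤1 : ∀ i j → count n (λ t → P (i , j , t)) ≤ 1
  z-file≤1 i j = rooks-on-file≤1 (λ t → i , j , t) (λ { refl → refl })
    λ _ _ → +-mono-≤ (+-mono-≤ (agreement-refl i) (agreement-refl j)) z≤n

  rooks+Ez : ∀ A B → rooksIn P A B ⊤ + Ez P A B ≡ ∣ A ∣ * ∣ B ∣
  rooks+Ez A B = begin
    rooksIn P A B ⊤ + Ez P A B
      ≡⟨ cong (_+ Ez P A B) (sumF³-cong n λ i j k →
           cong (λ t → χ (i ∈ᵇ A ∧ j ∈ᵇ B ∧ t ∧ P (i , j , k))) (∈⊤ k)) ⟩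
    sumF n (λ i → sumF n λ j → count n λ t → i ∈ᵇ A ∧ j ∈ᵇ B ∧ P (i , j , t)) + Ez P A B
      ≡⟨ rooks+empty-files n (lookup A) (lookup B) (λ i j t → P (i , j , t)) z-file≤1 ⟩
    count n (lookup A) * count n (lookup B)
      ≡⟨ cong₂ _*_ (∣p∣≡count A) (∣p∣≡count B) ⟨
    ∣ A ∣ * ∣ B ∣ ∎

  rooks+Ex : ∀ B C → rooksIn P ⊤ B C + Ex P B C ≡ ∣ B ∣ * ∣ C ∣
  rooks+Ex B C = begin
    rooksIn P ⊤ B C + Ex P B C
      ≡⟨ cong (_+ Ex P B C) (sumF³-cong n λ i j k →
           cong (λ t → χ (t ∧ j ∈ᵇ B ∧ k ∈ᵇ C ∧ P (i , j , k))) (∈⊤ i)) ⟩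
    sumF n (λ i → sumF n λ j → count n λ k → j ∈ᵇ B ∧ k ∈ᵇ C ∧ P (i , j , k)) + Ex P B C
      ≡⟨ cong (_+ Ex P B C) (trans (sumF-comm n n _) (sumF-cong n λ j → sumF-comm n n _)) ⟩
    sumF n (λ j → sumF n λ k → count n λ t → j ∈ᵇ B ∧ k ∈ᵇ C ∧ P (t , j , k)) + Ex P B C
      ≡⟨ rooks+empty-files n (lookup B) (lookup C) (λ j k t → P (t , j , k)) x-file≤1 ⟩
    count n (lookup B) * count n (lookup C)
      ≡⟨ cong₂ _*_ (∣p∣≡count B) (∣p∣≡count C) ⟨
    ∣ B ∣ * ∣ C ∣ ∎

  rooks+Ey : ∀ A C → rooksIn P A ⊤ C + Ey P A C ≡ ∣ A ∣ * ∣ C ∣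
  rooks+Ey A C = begin
    rooksIn P A ⊤ C + Ey P A C
      ≡⟨ cong (_+ Ey P A C) (sumF³-cong n λ i j k →
           cong (λ t → χ (i ∈ᵇ A ∧ t ∧ k ∈ᵇ C ∧ P (i , j , k))) (∈⊤ j)) ⟩
    sumF n (λ i → sumF n λ j → count n λ k → i ∈ᵇ A ∧ k ∈ᵇ C ∧ P (i , j , k)) + Ey P A C
      ≡⟨ cong (_+ Ey P A C) (sumF-cong n λ i → sumF-comm n n _) ⟩
    sumF n (λ i → sumF n λ k → count n λ t → i ∈ᵇ A ∧ k ∈ᵇ C ∧ P (i , t , k)) + Ey P A C
      ≡⟨ rooks+empty-files n (lookup A) (lookup C) (λ i k t → P (i , t , k)) y-file≤1 ⟩
    count n (lookup A) * count n (lookup C)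
      ≡⟨ cong₂ _*_ (∣p∣≡count A) (∣p∣≡count C) ⟨
    ∣ A ∣ * ∣ C ∣ ∎

rook∈ : ∀ {n} → Rooks n → Subset n → Subset n → Subset n → Fin n → Fin n → Fin n → ℕ
rook∈ P A B C i j k = χ (i ∈ᵇ A ∧ j ∈ᵇ B ∧ k ∈ᵇ C ∧ P (i , j , k))

brick-cover : ∀ x y z p {x' y' z' tx ty tz} →
  x' ≡ not x → y' ≡ not y → z' ≡ not z → tx ≡ true → ty ≡ true → tz ≡ true →
  χ (x' ∧ y' ∧ z' ∧ p) + χ (tx ∧ y' ∧ z ∧ p) + χ (x ∧ ty ∧ z' ∧ p) + χ (x ∧ y ∧ z ∧ p)
  ≡ χ (x ∧ y ∧ tz ∧ p) + χ (x ∧ y' ∧ tz ∧ p) + χ (x' ∧ y' ∧ tz ∧ p)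
brick-cover true  true  true  true  refl refl refl refl refl refl = refl
brick-cover true  true  true  false refl refl refl refl refl refl = refl
brick-cover true  true  false true  refl refl refl refl refl refl = refl
brick-cover true  true  false false refl refl refl refl refl refl = refl
brick-cover true  false true  true  refl refl refl refl refl refl = refl
brick-cover true  false true  false refl refl refl refl refl refl = refl
brick-cover true  false false true  refl refl refl refl refl refl = refl
brick-cover true  false false false refl refl refl refl refl refl = refl
brick-cover false true  true  true  refl refl refl refl refl refl = refl
brick-cover false true  true  false refl refl refl refl refl refl = refl
brick-cover false true  false true  refl refl refl refl refl refl = refl
brick-cover false true  false false refl refl refl refl refl refl = refl
brick-cover false false true  true  refl refl refl refl refl refl = refl
brick-cover false false true  false refl refl refl refl refl refl = refl
brick-cover false false false true  refl refl refl refl refl refl = refl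
brick-cover false false false false refl refl refl refl refl refl = refl

rooks-tiling : ∀ {n} (P : Rooks n) I J K →
  rooksIn P (∁ I) (∁ J) (∁ K) + rooksIn P ⊤ (∁ J) K + rooksIn P I ⊤ (∁ K) + rooksIn P I J K
  ≡ rooksIn P I J ⊤ + rooksIn P I (∁ J) ⊤ + rooksIn P (∁ I) (∁ J) ⊤
rooks-tiling {n} P I J K = begin
  sumF³ n f₃ + sumF³ n f₄ + sumF³ n f₅ + sumF³ n f₀
    ≡⟨ cong (_+ sumF³ n f₀) (cong (_+ sumF³ n f₅) (sumF³-distrib-+ n f₃ f₄)) ⟨
  sumF³ n (λ i j k → f₃ i j k + f₄ i j k) + sumF³ n f₅ + sumF³ n f₀
    ≡⟨ cong (_+ sumF³ n f₀) (sumF³-distrib-+ n _ f₅) ⟨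
  sumF³ n (λ i j k → f₃ i j k + f₄ i j k + f₅ i j k) + sumF³ n f₀
    ≡⟨ sumF³-distrib-+ n _ f₀ ⟨
  sumF³ n (λ i j k → f₃ i j k + f₄ i j k + f₅ i j k + f₀ i j k)
    ≡⟨ sumF³-cong n (λ i j k → brick-cover (i ∈ᵇ I) (j ∈ᵇ J) (k ∈ᵇ K) (P (i , j , k))
         (lookup-map i not I) (lookup-map j not J) (lookup-map k not K) (∈⊤ i) (∈⊤ j) (∈⊤ k)) ⟩
  sumF³ n (λ i j k → g₁ i j k + g₂ i j k + g₃ i j k)
    ≡⟨ sumF³-distrib-+ n _ g₃ ⟩
  sumF³ n (λ i j k → g₁ i j k + g₂ i j k) + sumF³ n g₃
    ≡⟨ cong (_+ sumF³ n g₃) (sumF³-distrib-+ n g₁ g₂) ⟩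
  sumF³ n g₁ + sumF³ n g₂ + sumF³ n g₃ ∎
  where
  f₀ f₃ f₄ f₅ g₁ g₂ g₃ : Fin n → Fin n → Fin n → ℕ
  f₀ = rook∈ P I J K
  f₃ = rook∈ P (∁ I) (∁ J) (∁ K)
  f₄ = rook∈ P ⊤ (∁ J) K
  f₅ = rook∈ P I ⊤ (∁ K)
  g₁ = rook∈ P I J ⊤
  g₂ = rook∈ P I (∁ J) ⊤
  g₃ = rook∈ P (∁ I) (∁ J) ⊤

deficiency-polynomial : ∀ n a b c r₁ r₂ r₃ r₄ r₅ t₃ {a' b' c' e₁ e₂ e₃ e₄ e₅ t₀ : ℤ} →
  a' ≡ n - a → b' ≡ n - b → c' ≡ n - c →
  e₁ ≡ a *ℤ b - r₁ → e₂ ≡ a *ℤ b' - r₂ → e₃ ≡ a' *ℤ b' - r₃ →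
  e₄ ≡ b' *ℤ c - r₄ → e₅ ≡ a *ℤ c' - r₅ →
  t₀ ≡ r₁ +ℤ r₂ +ℤ r₃ - (t₃ +ℤ r₄ +ℤ r₅) →
  n *ℤ n - (a +ℤ b +ℤ c) *ℤ n +ℤ (a *ℤ b +ℤ b *ℤ c +ℤ c *ℤ a) - t₀ - t₃
    ≡ e₁ +ℤ e₂ +ℤ e₃ - e₄ - e₅
deficiency-polynomial n a b c r₁ r₂ r₃ r₄ r₅ t₃
  refl refl refl refl refl refl refl refl refl =
  solve (n ∷ a ∷ b ∷ c ∷ r₁ ∷ r₂ ∷ r₃ ∷ r₄ ∷ r₅ ∷ t₃ ∷ [])

pos-sub : ∀ x {y z} → x + y ≡ z → + y ≡ + z - + x
pos-sub x {y} refl = add-sub (+ y) (+ x)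
  where
  add-sub : ∀ u v → u ≡ v +ℤ u - v
  add-sub = solve-∀

pos-sub-* : ∀ x u {y v} → x + y ≡ u * v → + y ≡ + u *ℤ + v - + x
pos-sub-* x u {v = v} eq = trans (pos-sub x eq) (cong (_- + x) (pos-* u v))

-- The explicit arguments are the left summands of the hypotheses; they let Agda
-- infer the remaining counts by unification.
deficiency-from-counts : ∀ n a b c r₁ r₂ r₃ r₄ r₅ t₃ {a' b' c' e₁ e₂ e₃ e₄ e₅ t₀ : ℕ} →
  a + a' ≡ n → b + b' ≡ n → c + c' ≡ n →
  r₁ + e₁ ≡ a * b → r₂ + e₂ ≡ a * b' → r₃ + e₃ ≡ a' * b' → r₄ + e₄ ≡ b' * c → r₅ + e₅ ≡ a * c' →
  t₃ + r₄ + r₅ + t₀ ≡ r₁ + r₂ + r₃ →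
  + (n * n) - + ((a + b + c) * n) +ℤ + (a * b + b * c + c * a) - + t₀ - + t₃
    ≡ + e₁ +ℤ + e₂ +ℤ + e₃ - + e₄ - + e₅
deficiency-from-counts n a b c r₁ r₂ r₃ r₄ r₅ t₃ {a'} {b'} {c'} {t₀ = t₀}
                       ha hb hc h₁ h₂ h₃ h₄ h₅ ht =
  trans (cong (λ d → d - + t₀ - + t₃) pos-polynomial)
        (deficiency-polynomial (+ n) (+ a) (+ b) (+ c) (+ r₁) (+ r₂) (+ r₃) (+ r₄) (+ r₅) (+ t₃)
          (pos-sub a ha) (pos-sub b hb) (pos-sub c hc)
          (pos-sub-* r₁ a h₁) (pos-sub-* r₂ a h₂) (pos-sub-* r₃ a' h₃)
          (pos-sub-* r₄ b' h₄) (pos-sub-* r₅ a h₅)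
          (pos-sub (t₃ + r₄ + r₅) ht))
  where
  pos-polynomial : + (n * n) - + ((a + b + c) * n) +ℤ + (a * b + b * c + c * a)
    ≡ + n *ℤ + n - (+ a +ℤ + b +ℤ + c) *ℤ + n +ℤ (+ a *ℤ + b +ℤ + b *ℤ + c +ℤ + c *ℤ + a)
  pos-polynomial = cong₂ _+ℤ_ (cong₂ _-_ (pos-* n n) (pos-* (a + b + c) n))
                              (cong₂ _+ℤ_ (cong₂ _+ℤ_ (pos-* a b) (pos-* b c)) (pos-* c a))

theorem6p5 : (n : ℕ) (P : Rooks n) → NonAttacking P → (I J K : Subset n) →
    deficiency P I J K ≡
      + (Ez P I J) +ℤ + (Ez P I (∁ J)) +ℤ + (Ez P (∁ I) (∁ J))
        - + (Ex P (∁ J) K) - + (Ey P I (∁ K))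
theorem6p5 n P non-attacking I J K =
  deficiency-from-counts n (∣ I ∣) (∣ J ∣) (∣ K ∣)
    (rooksIn P I J ⊤) (rooksIn P I (∁ J) ⊤) (rooksIn P (∁ I) (∁ J) ⊤)
    (rooksIn P ⊤ (∁ J) K) (rooksIn P I ⊤ (∁ K)) (rooksIn P (∁ I) (∁ J) (∁ K))
    (∣p∣+∣∁p∣≡n I) (∣p∣+∣∁p∣≡n J) (∣p∣+∣∁p∣≡n K)
    (rooks+Ez non-attacking I J) (rooks+Ez non-attacking I (∁ J))
    (rooks+Ez non-attacking (∁ I) (∁ J))
    (rooks+Ex non-attacking (∁ J) K) (rooks+Ey non-attacking I (∁ K))
    (rooks-tiling P I J K)
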